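{- Let $\mathcal{L}=(L,\prec_{\mathcal{L}})$ be a computable linear order, let $C\subseteq\mathbb{N}$ be cohesive, and let $[\psi]$ and $[\varphi]$ be elements of $\Pi_C\mathcal{L}$. Then the following are equivalent: (1) $[\psi]\ll_{\Pi_C\mathcal{L}}[\varphi]$; (2) $\lim_{n\in C}|(\psi(n),\varphi(n))_{\mathcal{L}}|=\infty$; (3) $\limsup_{n\in C}|(\psi(n),\varphi(n))_{\mathcal{L}}|=\infty$.
   Context: A set $C\subseteq\mathbb{N}$ is cohesive if it is infinite and for every c.e. set $W$, either $C\setminus W$ or $C\cap W$ is finite. Write $X\subseteq^* Y$ if $X\setminus Y$ is finite. For a computable linear order $\mathcal{L}=(L,\prec_{\mathcal{L}})$, the cohesive power $\Pi_C\mathcal{L}$ has as elements the classes $[\varphi]$ of partial computable $\varphi\colon\mathbb{N}\to L$ with $C\subseteq^*\mathrm{dom}(\varphi)$ under $\varphi=_C\psi$ iff $C\subseteq^*\{x:\varphi(x)\downarrow=\psi(x)\downarrow\}$, ordered by $[\varphi]\prec[\psi]$ iff $C\subseteq^*\{x:\varphi(x)\downarrow,\psi(x)\downarrow,\varphi(x)\prec_{\mathcal{L}}\psi(x)\}$. For a linear order $\mathcal{M}$, $(a,b)_{\mathcal{M}}=\{x:a\prec x\prec b\}$ (empty if $b\preceq a$), and $a\ll_{\mathcal{M}}b$ means that $(a,b)_{\mathcal{M}}$ is infinite. If $n_0<n_1<\cdots$ enumerates $C$, then $\lim_{n\in C}f(n)$ means $\lim_{i\to\infty}f(n_i)$, and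 similarly for $\limsup$ (the functions considered are defined for all but finitely many $n\in C$). -}

module Defs where

open import Data.Nat using (ℕ; zero; suc; _<_; _≤_)
open import Data.Fin using (Fin)
open import Data.Vec using (Vec; []; _∷_; lookup)
open import Data.List using (List)
open import Data.List.Membership.Propositional using (_∈_)
open import Data.Product using (Σ; ∃; _×_; _,_)
open import Data.Sum using (_⊎_)
open import Data.Empty using (⊥)
open import Relation.Nullary using (¬_)
open import Relation.Binary.PropositionalEquality using (_≡_)
open import Function.Bundles using (_⇔_)

-- Model of computation: (codes of) partial μ-recursive functions.

data PR : ℕ → Set where
  zer  : ∀ {n} → PR n
  sc   : PR 1
  proj : ∀ {n} → Fin n → PR n
  comp : ∀ {n m} → PR m → Vec (PR n) m → PR n
  prec : ∀ {n} → PR n → PR (suc (suc n)) → PR (suc n)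
  mu   : ∀ {n} → PR (suc n) → PR n

-- Big-step semantics:  f ⊢ xs ⇓ y  means  f(xs)↓ = y.
data _⊢_⇓_ : ∀ {n} → PR n → Vec ℕ n → ℕ → Set
data _⊢*_⇓_ : ∀ {n m} → Vec (PR n) m → Vec ℕ n → Vec ℕ m → Set

data _⊢_⇓_ where
  ev-zer  : ∀ {n} {xs : Vec ℕ n} → zer ⊢ xs ⇓ 0
  ev-sc   : ∀ {x} → sc ⊢ (x ∷ []) ⇓ suc x
  ev-proj : ∀ {n} {i : Fin n} {xs} → proj i ⊢ xs ⇓ lookup xs i
  ev-comp : ∀ {n m} {f : PR m} {gs : Vec (PR n) m} {xs ys y} →
            gs ⊢* xs ⇓ ys → f ⊢ ys ⇓ y → comp f gs ⊢ xs ⇓ y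
  ev-prec-z : ∀ {n} {g : PR n} {h xs y} →
            g ⊢ xs ⇓ y → prec g h ⊢ (zero ∷ xs) ⇓ y
  ev-prec-s : ∀ {n} {g : PR n} {h k xs y z} →
            prec g h ⊢ (k ∷ xs) ⇓ y → h ⊢ (k ∷ y ∷ xs) ⇓ z →
            prec g h ⊢ (suc k ∷ xs) ⇓ z
  ev-mu   : ∀ {n} {f : PR (suc n)} {xs y} →
            f ⊢ (y ∷ xs) ⇓ 0 →
            (∀ z → z < y → Σ ℕ λ k → f ⊢ (z ∷ xs) ⇓ suc k) →
            mu f ⊢ xs ⇓ y

data _⊢*_⇓_ where
  ev-[] : ∀ {n} {xs : Vec ℕ n} → [] ⊢* xs ⇓ []
  ev-∷  : ∀ {n m} {g : PR n} {gs : Vec (PR n) m} {xs y ys} →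
          g ⊢ xs ⇓ y → gs ⊢* xs ⇓ ys → (g ∷ gs) ⊢* xs ⇓ (y ∷ ys)

_⟨_⟩≡_ : PR 1 → ℕ → ℕ → Set
φ ⟨ x ⟩≡ y = φ ⊢ (x ∷ []) ⇓ y

-- domain of a unary partial computable function (= a c.e. set)
Dom : PR 1 → ℕ → Set
Dom φ x = ∃ λ y → φ ⟨ x ⟩≡ y

Finite : (ℕ → Set) → Set
Finite S = ∃ λ N → ∀ n → S n → n < N

Infinite : (ℕ → Set) → Set
Infinite S = ¬ Finite S

_⊆*_ : (ℕ → Set) → (ℕ → Set) → Set
X ⊆* Y = Finite (λ n → X n × ¬ Y n)

Cohesive : (ℕ → Set) → Set
Cohesive C = Infinite C ×
  (∀ (e : PR 1) → Finite (λ n → C n × ¬ Dom e n) ⊎ Finite (λ n → C n × Dom e n))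

-- Computable linear orders  (L, ≺) with L ⊆ ℕ, given by total
-- computable characteristic functions dL (of L) and rL (of ≺).

InL : PR 1 → ℕ → Set
InL dL x = dL ⊢ (x ∷ []) ⇓ 1

Lt : PR 2 → ℕ → ℕ → Set
Lt rL x y = rL ⊢ (x ∷ y ∷ []) ⇓ 1

record IsCompLinOrder (dL : PR 1) (rL : PR 2) : Set where
  field
    dL-total : ∀ x → (dL ⊢ (x ∷ []) ⇓ 0) ⊎ (dL ⊢ (x ∷ []) ⇓ 1)
    rL-total : ∀ x y → (rL ⊢ (x ∷ y ∷ []) ⇓ 0) ⊎ (rL ⊢ (x ∷ y ∷ []) ⇓ 1)
    irrefl   : ∀ x → InL dL x → ¬ Lt rL x x
    trans    : ∀ x y z → InL dL x → InL dL y → InL dL z →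
               Lt rL x y → Lt rL y z → Lt rL x z
    trichot  : ∀ x y → InL dL x → InL dL y →
               Lt rL x y ⊎ (x ≡ y ⊎ Lt rL y x)

IntervalL : PR 1 → PR 2 → ℕ → ℕ → ℕ → Set
IntervalL dL rL a b x = InL dL x × Lt rL a x × Lt rL x b

AtLeast : ℕ → (ℕ → Set) → Set
AtLeast k S = Σ (Fin k → ℕ) λ f → (∀ i j → f i ≡ f j → i ≡ j) × (∀ i → S (f i))

-- Cohesive power Π_C L.  Elements: partial computable φ : ℕ → L with
-- C ⊆* dom φ, taken modulo =_C.

IsElem : PR 1 → (ℕ → Set) → PR 1 → Set
IsElem dL C φ = (∀ x y → φ ⟨ x ⟩≡ y → InL dL y) × (C ⊆* Dom φ)

_=[_]_ : PR 1 → (ℕ → Set) → PR 1 → Set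
φ =[ C ] ψ = C ⊆* (λ x → ∃ λ y → φ ⟨ x ⟩≡ y × ψ ⟨ x ⟩≡ y)

PowLt : PR 2 → (ℕ → Set) → PR 1 → PR 1 → Set
PowLt rL C φ ψ =
  C ⊆* (λ x → ∃ λ a → ∃ λ b → φ ⟨ x ⟩≡ a × ψ ⟨ x ⟩≡ b × Lt rL a b)

PowInterval : PR 1 → PR 2 → (ℕ → Set) → PR 1 → PR 1 → PR 1 → Set
PowInterval dL rL C ψ φ θ = IsElem dL C θ × PowLt rL C ψ θ × PowLt rL C θ φ

-- a set of elements of Π_C L is finite if finitely many classes cover it
PowFinite : (ℕ → Set) → (PR 1 → Set) → Set
PowFinite C P = Σ (List (PR 1)) λ l →
  ∀ θ → P θ → Σ (PR 1) λ θ' → θ' ∈ l × θ =[ C ] θ'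

PowFar : PR 1 → PR 2 → (ℕ → Set) → PR 1 → PR 1 → Set
PowFar dL rL C ψ φ = ¬ PowFinite C (PowInterval dL rL C ψ φ)

IntAtLeast : PR 1 → PR 2 → PR 1 → PR 1 → ℕ → ℕ → Set
IntAtLeast dL rL ψ φ k n = ∃ λ a → ∃ λ b →
  ψ ⟨ n ⟩≡ a × φ ⟨ n ⟩≡ b × AtLeast k (IntervalL dL rL a b)

LimInfty : PR 1 → PR 2 → (ℕ → Set) → PR 1 → PR 1 → Set
LimInfty dL rL C ψ φ = ∀ k → C ⊆* IntAtLeast dL rL ψ φ k

LimsupInfty : PR 1 → PR 2 → (ℕ → Set) → PR 1 → PR 1 → Set
LimsupInfty dL rL C ψ φ = ∀ k → Infinite (λ n → C n × IntAtLeast dL rL ψ φ k n)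

-- For fixed j, the j-th element, in the order of ℕ, of the interval (ψ(n), φ(n)) is a partial
-- computable function nth_j of n, and the sets of those n where this interval has at least k
-- elements, or where θ(n) is its j-th element, are c.e.  If the interval grows without bound
-- along C, the [nth_j] are infinitely many pairwise distinct elements of ([ψ], [φ]).  Conversely,
-- cohesiveness makes C almost contained in or almost disjoint from each of these c.e. sets.  This
-- turns an unbounded limsup into a limit; and if the interval has fewer than k elements for
-- almost all n ∈ C, it forces every [θ] ∈ ([ψ], [φ]) to be one of [nth_0], …, [nth_(k-1)].
module Submission where

open import Defs
open import Data.Bool using (if_then_else_)
open import Data.Empty using (⊥-elim)
open import Data.Fin as Fin using (Fin; toℕ; fromℕ<; #_)
open import Data.Fin.Properties using (toℕ-fromℕ<; toℕ-injective; toℕ<n; injective⇒≤; pigeonhole)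
open import Data.List using (length; lookup; applyUpTo)
open import Data.List.Membership.Propositional using (_∈_)
open import Data.List.Membership.Propositional.Properties using (∈-applyUpTo⁺)
open import Data.List.Relation.Unary.Any using (index)
open import Data.List.Relation.Unary.Any.Properties using (lookup-index)
open import Data.Nat using (ℕ; zero; suc; pred; _+_; _∸_; _⊔_; _≤_; _<_; _≟_; _<?_; z≤n; ≢-nonZero)
open import Data.Nat.Properties
open import Data.Product using (Σ; ∃; _×_; _,_; proj₁; proj₂)
open import Data.Sum using (_⊎_; inj₁; inj₂; [_,_]′)
open import Data.Vec using (Vec; []; _∷_)
open import Function using (_∘_)
open import Function.Bundles using (_⇔_; mk⇔)
open import Relation.Binary using (tri<; tri≈; tri>)
open import Relation.Binary.PropositionalEquality
  using (_≡_; refl; sym; trans; cong; cong₂; subst; module ≡-Reasoning)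
open import Relation.Nullary
  using (¬_; Dec; yes; no; does; _×-dec_; decidable-stable; contradiction)
open import Relation.Unary using (Decidable)

⇓-functional : ∀ {n} {f : PR n} {xs y z} → f ⊢ xs ⇓ y → f ⊢ xs ⇓ z → y ≡ z
⇓*-functional : ∀ {n m} {gs : Vec (PR n) m} {xs ys zs} → gs ⊢* xs ⇓ ys → gs ⊢* xs ⇓ zs → ys ≡ zs
⇓-functional ev-zer ev-zer = refl
⇓-functional ev-sc ev-sc = refl
⇓-functional ev-proj ev-proj = refl
⇓-functional (ev-comp gs⇓ f⇓) (ev-comp gs⇓′ f⇓′) with refl ← ⇓*-functional gs⇓ gs⇓′ =
  ⇓-functional f⇓ f⇓′
⇓-functional (ev-prec-z g⇓) (ev-prec-z g⇓′) = ⇓-functional g⇓ g⇓′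
⇓-functional (ev-prec-s r⇓ h⇓) (ev-prec-s r⇓′ h⇓′) with refl ← ⇓-functional r⇓ r⇓′ =
  ⇓-functional h⇓ h⇓′
⇓-functional (ev-mu {y = y} f⇓0 positive) (ev-mu {y = y′} f⇓0′ positive′) with <-cmp y y′
... | tri< y<y′ _ _ = ⊥-elim (0≢1+n (⇓-functional f⇓0 (proj₂ (positive′ y y<y′))))
... | tri≈ _ y≡y′ _ = y≡y′
... | tri> _ _ y′<y = ⊥-elim (0≢1+n (⇓-functional f⇓0′ (proj₂ (positive y′ y′<y))))
⇓*-functional ev-[] ev-[] = refl
⇓*-functional (ev-∷ g⇓ gs⇓) (ev-∷ g⇓′ gs⇓′) =
  cong₂ _∷_ (⇓-functional g⇓ g⇓′) (⇓*-functional gs⇓ gs⇓′)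

comp₁ : ∀ {n} → PR 1 → PR n → PR n
comp₁ f g = comp f (g ∷ [])

comp₂ : ∀ {n} → PR 2 → PR n → PR n → PR n
comp₂ f g h = comp f (g ∷ h ∷ [])

comp₃ : ∀ {n} → PR 3 → PR n → PR n → PR n → PR n
comp₃ f g h k = comp f (g ∷ h ∷ k ∷ [])

⇓-comp₁ : ∀ {n} {f : PR 1} {g : PR n} {xs y z} →
          g ⊢ xs ⇓ y → f ⊢ y ∷ [] ⇓ z → comp₁ f g ⊢ xs ⇓ z
⇓-comp₁ g⇓ f⇓ = ev-comp (ev-∷ g⇓ ev-[]) f⇓

⇓-comp₂ : ∀ {n} {f : PR 2} {g h : PR n} {xs y y′ z} →
          g ⊢ xs ⇓ y → h ⊢ xs ⇓ y′ → f ⊢ y ∷ y′ ∷ [] ⇓ z → comp₂ f g h ⊢ xs ⇓ z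
⇓-comp₂ g⇓ h⇓ f⇓ = ev-comp (ev-∷ g⇓ (ev-∷ h⇓ ev-[])) f⇓

⇓-comp₃ : ∀ {n} {f : PR 3} {g h k : PR n} {xs y y′ y″ z} →
          g ⊢ xs ⇓ y → h ⊢ xs ⇓ y′ → k ⊢ xs ⇓ y″ → f ⊢ y ∷ y′ ∷ y″ ∷ [] ⇓ z →
          comp₃ f g h k ⊢ xs ⇓ z
⇓-comp₃ g⇓ h⇓ k⇓ f⇓ = ev-comp (ev-∷ g⇓ (ev-∷ h⇓ (ev-∷ k⇓ ev-[]))) f⇓

constᴾ : ∀ {n} → ℕ → PR n
constᴾ zero = zer
constᴾ (suc c) = comp₁ sc (constᴾ c)

⇓-constᴾ : ∀ {n} c {xs : Vec ℕ n} → constᴾ c ⊢ xs ⇓ c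
⇓-constᴾ zero = ev-zer
⇓-constᴾ (suc c) = ⇓-comp₁ (⇓-constᴾ c) ev-sc

addᴾ : PR 2
addᴾ = prec (proj (# 0)) (comp₁ sc (proj (# 1)))

⇓-addᴾ : ∀ m n → addᴾ ⊢ m ∷ n ∷ [] ⇓ (m + n)
⇓-addᴾ zero n = ev-prec-z ev-proj
⇓-addᴾ (suc m) n = ev-prec-s (⇓-addᴾ m n) (⇓-comp₁ ev-proj ev-sc)

predᴾ : PR 1
predᴾ = prec zer (proj (# 0))

⇓-predᴾ : ∀ n → predᴾ ⊢ n ∷ [] ⇓ pred n
⇓-predᴾ zero = ev-prec-z ev-zer
⇓-predᴾ (suc n) = ev-prec-s (⇓-predᴾ n) ev-proj

-- The recursion runs on the subtrahend, which therefore comes first.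
monusᴾ : PR 2
monusᴾ = prec (proj (# 0)) (comp₁ predᴾ (proj (# 1)))

⇓-monusᴾ : ∀ n m → monusᴾ ⊢ n ∷ m ∷ [] ⇓ (m ∸ n)
⇓-monusᴾ zero m = ev-prec-z ev-proj
⇓-monusᴾ (suc n) m = subst (monusᴾ ⊢ suc n ∷ m ∷ [] ⇓_) (pred[m∸n]≡m∸[1+n] m n)
  (ev-prec-s (⇓-monusᴾ n m) (⇓-comp₁ ev-proj (⇓-predᴾ (m ∸ n))))

infixl 25 _+ᴾ_ _∸ᴾ_

_+ᴾ_ : ∀ {n} → PR n → PR n → PR n
g +ᴾ h = comp₂ addᴾ g h

_∸ᴾ_ : ∀ {n} → PR n → PR n → PR n
g ∸ᴾ h = comp₂ monusᴾ h g

⇓-+ᴾ : ∀ {n} {g h : PR n} {xs a b} → g ⊢ xs ⇓ a → h ⊢ xs ⇓ b → g +ᴾ h ⊢ xs ⇓ (a + b)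
⇓-+ᴾ g⇓ h⇓ = ⇓-comp₂ g⇓ h⇓ (⇓-addᴾ _ _)

⇓-∸ᴾ : ∀ {n} {g h : PR n} {xs a b} → g ⊢ xs ⇓ a → h ⊢ xs ⇓ b → g ∸ᴾ h ⊢ xs ⇓ (a ∸ b)
⇓-∸ᴾ g⇓ h⇓ = ⇓-comp₂ h⇓ g⇓ (⇓-monusᴾ _ _)

-- μy. x, which is defined exactly at x = 0.
isZeroᴾ : PR 1
isZeroᴾ = mu (proj (# 1))

⇓-isZeroᴾ : isZeroᴾ ⊢ 0 ∷ [] ⇓ 0
⇓-isZeroᴾ = ev-mu ev-proj (λ _ ())

isZeroᴾ-⇓⇒≡0 : ∀ {x y} → isZeroᴾ ⊢ x ∷ [] ⇓ y → x ≡ 0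
isZeroᴾ-⇓⇒≡0 (ev-mu ev-proj _) = refl

bit : ∀ {A : Set} → Dec A → ℕ
bit a? = if does a? then 1 else 0

decide-⇓1 : ∀ {n} {f : PR n} {xs} → (f ⊢ xs ⇓ 0) ⊎ (f ⊢ xs ⇓ 1) → Dec (f ⊢ xs ⇓ 1)
decide-⇓1 (inj₁ f⇓0) = no λ f⇓1 → 0≢1+n (⇓-functional f⇓0 f⇓1)
decide-⇓1 (inj₂ f⇓1) = yes f⇓1

⇓-bit-decide-⇓1 : ∀ {n} {f : PR n} {xs} (f⇓01 : (f ⊢ xs ⇓ 0) ⊎ (f ⊢ xs ⇓ 1)) →
                  f ⊢ xs ⇓ bit (decide-⇓1 f⇓01)
⇓-bit-decide-⇓1 (inj₁ f⇓0) = f⇓0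
⇓-bit-decide-⇓1 (inj₂ f⇓1) = f⇓1

bit-×-dec : ∀ {A B D : Set} (a? : Dec A) (b? : Dec B) (d? : Dec D) →
            (bit a? + (bit b? + bit d?)) ∸ 2 ≡ bit (a? ×-dec (b? ×-dec d?))
bit-×-dec (yes _) (yes _) (yes _) = refl
bit-×-dec (yes _) (yes _) (no _)  = refl
bit-×-dec (yes _) (no _)  (yes _) = refl
bit-×-dec (yes _) (no _)  (no _)  = refl
bit-×-dec (no _)  (yes _) (yes _) = refl
bit-×-dec (no _)  (yes _) (no _)  = refl
bit-×-dec (no _)  (no _)  (yes _) = refl
bit-×-dec (no _)  (no _)  (no _)  = refl

1∸bit≡0⇒ : ∀ {A : Set} (a? : Dec A) → 1 ∸ bit a? ≡ 0 → A
1∸bit≡0⇒ (yes a) _ = a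

⇒1∸bit≡0 : ∀ {A : Set} (a? : Dec A) → A → 1 ∸ bit a? ≡ 0
⇒1∸bit≡0 (yes _) _ = refl
⇒1∸bit≡0 (no ¬a) a = contradiction a ¬a

m∸n+n∸m≡0⇒m≡n : ∀ {m n} → (m ∸ n) + (n ∸ m) ≡ 0 → m ≡ n
m∸n+n∸m≡0⇒m≡n {m} {n} eq =
  ≤-antisym (m∸n≡0⇒m≤n (m+n≡0⇒m≡0 (m ∸ n) eq)) (m∸n≡0⇒m≤n (m+n≡0⇒n≡0 (m ∸ n) eq))

extend-below : ∀ {Q : ℕ → Set} {m} → (∀ z → z < m → Q z) → Q m → ∀ z → z < suc m → Q z
extend-below below Qm z z<1+m with m<1+n⇒m<n∨m≡n z<1+m
... | inj₁ z<m = below z z<m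
... | inj₂ refl = Qm

least-witness : ∀ {P : ℕ → Set} → Decidable P → ∀ {y} → P y →
                ∃ λ x → P x × (∀ z → z < x → ¬ P z)
least-witness {P} P? {y} Py with search (suc y)
  where
  search : ∀ m → (∀ z → z < m → ¬ P z) ⊎ (∃ λ x → P x × (∀ z → z < x → ¬ P z))
  search zero = inj₁ λ _ ()
  search (suc m) with search m | P? m
  ... | inj₂ least | _ = inj₂ least
  ... | inj₁ none | yes Pm = inj₂ (m , Pm , none)
  ... | inj₁ none | no ¬Pm = inj₁ (extend-below none ¬Pm)
... | inj₁ none = contradiction Py (none y (n<1+n y))
... | inj₂ least = least

module _ {n} {f : PR (suc n)} {xs : Vec ℕ n} {F : ℕ → ℕ} (⇓F : ∀ y → f ⊢ y ∷ xs ⇓ F y) where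

  μ-sound : ∀ {y} → mu f ⊢ xs ⇓ y → F y ≡ 0
  μ-sound (ev-mu f⇓0 _) = ⇓-functional (⇓F _) f⇓0

  μ-complete : ∀ {y} → F y ≡ 0 → ∃ λ x → mu f ⊢ xs ⇓ x
  μ-complete Fy≡0 with least-witness (λ y → F y ≟ 0) Fy≡0
  ... | x , Fx≡0 , below = x , ev-mu (subst (f ⊢ x ∷ xs ⇓_) Fx≡0 (⇓F x)) positive
    where
    positive : ∀ z → z < x → Σ ℕ λ k → f ⊢ z ∷ xs ⇓ suc k
    positive z z<x =
      pred (F z) , subst (f ⊢ z ∷ xs ⇓_) (sym (suc-pred (F z) {{≢-nonZero (below z z<x)}})) (⇓F z)

Finite-mono : ∀ {P Q : ℕ → Set} → (∀ {n} → P n → Q n) → Finite Q → Finite P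
Finite-mono P⇒Q (N , bound) = N , λ n p → bound n (P⇒Q p)

module _ {C : ℕ → Set} where

  ⊆*-mono : ∀ {P Q : ℕ → Set} → (∀ {n} → P n → Q n) → C ⊆* P → C ⊆* Q
  ⊆*-mono P⇒Q = Finite-mono λ (c , ¬q) → c , λ p → ¬q (P⇒Q p)

  -- Constructively, the two bounds combine because n < N is decidable, hence stable.
  ⊆*-∩ : ∀ {P Q : ℕ → Set} → C ⊆* P → C ⊆* Q → C ⊆* (λ n → P n × Q n)
  ⊆*-∩ (N , boundP) (M , boundQ) = N ⊔ M , λ n (c , ¬pq) →
    decidable-stable (n <? N ⊔ M) λ n≮N⊔M →
      (λ ¬p → n≮N⊔M (<-≤-trans (boundP n (c , ¬p)) (m≤m⊔n N M))) λ p →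
      (λ ¬q → n≮N⊔M (<-≤-trans (boundQ n (c , ¬q)) (m≤n⊔m N M))) λ q →
      ¬pq (p , q)

  Finite-∩⇒⊆*∁ : ∀ {W : ℕ → Set} → Finite (λ n → C n × W n) → C ⊆* (λ n → ¬ W n)
  Finite-∩⇒⊆*∁ (N , bound) = N , λ n (c , ¬¬w) →
    decidable-stable (n <? N) λ n≮N → ¬¬w λ w → n≮N (bound n (c , w))

  ⊆*-inhabited : ∀ {P : ℕ → Set} → Infinite C → C ⊆* P → ¬ ¬ (∃ λ n → C n × P n)
  ⊆*-inhabited inf (N , bound) ∄ = inf (N , λ n c → bound n (c , λ p → ∄ (n , c , p)))

  ⊆*⇒Infinite-∩ : ∀ {P : ℕ → Set} → Infinite C → C ⊆* P → Infinite (λ n → C n × P n)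
  ⊆*⇒Infinite-∩ inf C⊆*P fin =
    ⊆*-inhabited inf (⊆*-∩ C⊆*P (Finite-∩⇒⊆*∁ fin)) λ (_ , _ , p , ¬p) → ¬p p

  module _ (coh : Cohesive C) where

    cohesive-⊆*Dom : ∀ W → Infinite (λ n → C n × Dom W n) → C ⊆* Dom W
    cohesive-⊆*Dom W inf with proj₂ coh W
    ... | inj₁ C⊆*W = C⊆*W
    ... | inj₂ fin = ⊥-elim (inf fin)

    cohesive-some-or-none : (W : ℕ → PR 1) → ∀ k →
      (∃ λ j → j < k × C ⊆* Dom (W j)) ⊎ C ⊆* (λ n → ∀ j → j < k → ¬ Dom (W j) n)
    cohesive-some-or-none W zero = inj₂ (0 , λ _ (_ , ¬vacuous) → ⊥-elim (¬vacuous λ _ ()))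
    cohesive-some-or-none W (suc k) with cohesive-some-or-none W k
    ... | inj₁ (j , j<k , C⊆*Wj) = inj₁ (j , m<n⇒m<1+n j<k , C⊆*Wj)
    ... | inj₂ none with proj₂ coh (W k)
    ...   | inj₁ C⊆*Wk = inj₁ (k , n<1+n k , C⊆*Wk)
    ...   | inj₂ fin = inj₂ (⊆*-mono (λ (noneₖ , ¬Wk) → extend-below noneₖ ¬Wk)
                                     (⊆*-∩ none (Finite-∩⇒⊆*∁ fin)))

¬PowFinite-separated : ∀ {C : ℕ → Set} {P : PR 1 → Set} (g : ℕ → PR 1) → (∀ j → P (g j)) →
                       (∀ {i j θ} → g i =[ C ] θ → g j =[ C ] θ → i ≡ j) → ¬ PowFinite C P
¬PowFinite-separated {C} g Pg separated (l , cover) =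
  let i , j , i<j , same-slot = pigeonhole ≤-refl slot
  in <⇒≢ i<j (separated (g=representative (toℕ i))
                        (subst (g (toℕ j) =[ C ]_) (same-representative same-slot)
                               (g=representative (toℕ j))))
  where
  representative : ∀ i → Σ (PR 1) λ θ → θ ∈ l × g i =[ C ] θ
  representative i = cover (g i) (Pg i)

  g=representative : ∀ i → g i =[ C ] proj₁ (representative i)
  g=representative i = proj₂ (proj₂ (representative i))

  slot : Fin (suc (length l)) → Fin (length l)
  slot i = index (proj₁ (proj₂ (representative (toℕ i))))

  same-representative : ∀ {i j} → slot i ≡ slot j →
                        proj₁ (representative (toℕ j)) ≡ proj₁ (representative (toℕ i))
  same-representative {i} {j} eq = trans (lookup-index (proj₁ (proj₂ (representative (toℕ j)))))
    (trans (cong (lookup l) (sym eq)) (sym (lookup-index (proj₁ (proj₂ (representative (toℕ i)))))))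

fin-bound : ∀ {k} (f : Fin k → ℕ) → ∃ λ M → ∀ i → f i < M
fin-bound {zero} f = 0 , λ ()
fin-bound {suc k} f with fin-bound (f ∘ Fin.suc)
... | M , f<M = suc (f Fin.zero) ⊔ M , λ where
  Fin.zero → m≤m⊔n (suc (f Fin.zero)) M
  (Fin.suc i) → <-≤-trans (f<M i) (m≤n⊔m (suc (f Fin.zero)) M)

module Counting {P : ℕ → Set} (P? : Decidable P) where

  count : ℕ → ℕ
  count zero = 0
  count (suc x) = count x + bit (P? x)

  count-step : ∀ {x} → P x → count (suc x) ≡ suc (count x)
  count-step {x} Px with P? x
  ... | yes _ = +-comm (count x) 1
  ... | no ¬Px = contradiction Px ¬Px

  count-mono : ∀ {y x} → y ≤ x → count y ≤ count x
  count-mono {x = zero} z≤n = ≤-refl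
  count-mono {x = suc x} y≤1+x with m≤n⇒m<n∨m≡n y≤1+x
  ... | inj₁ y<1+x = ≤-trans (count-mono (≤-pred y<1+x)) (m≤m+n (count x) _)
  ... | inj₂ refl = ≤-refl

  count-strict : ∀ {y x} → y < x → P y → count y < count x
  count-strict y<x Py = ≤-trans (≤-reflexive (sym (count-step Py))) (count-mono y<x)

  count-injective : ∀ {x y} → P x → P y → count x ≡ count y → x ≡ y
  count-injective {x} {y} Px Py eq with <-cmp x y
  ... | tri< x<y _ _ = contradiction eq (<⇒≢ (count-strict x<y Px))
  ... | tri≈ _ x≡y _ = x≡y
  ... | tri> _ _ y<x = contradiction (sym eq) (<⇒≢ (count-strict y<x Py))

  -- Splitting on P? x also rewrites count (suc x) in the type of i<count.
  count-attained : ∀ {i x} → i < count x → ∃ λ y → y < x × P y × count y ≡ i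
  count-attained {i} {suc x} i<count with i <? count x | P? x
  ... | yes i<c | _ = let y , y<x , Py , eq = count-attained i<c in y , m<n⇒m<1+n y<x , Py , eq
  ... | no i≮c | yes Px =
    x , n<1+n x , Px , ≤-antisym (≮⇒≥ i≮c) (≤-pred (subst (i <_) (+-comm (count x) 1) i<count))
  ... | no i≮c | no ¬Px = contradiction (subst (i <_) (+-identityʳ (count x)) i<count) i≮c

  AtLeast⇒≤count : ∀ {k} → AtLeast k P → ∃ λ x → k ≤ count x
  AtLeast⇒≤count {k} (f , f-injective , Pf) = M , injective⇒≤ slot-injective
    where
    M : ℕ
    M = proj₁ (fin-bound f)

    slot : Fin k → Fin (count M)
    slot i = fromℕ< (count-strict (proj₂ (fin-bound f) i) (Pf i))

    slot-injective : ∀ {i j} → slot i ≡ slot j → i ≡ j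
    slot-injective {i} {j} eq = f-injective i j (count-injective (Pf i) (Pf j) (begin
      count (f i)    ≡⟨ sym (toℕ-fromℕ< _) ⟩
      toℕ (slot i)   ≡⟨ cong toℕ eq ⟩
      toℕ (slot j)   ≡⟨ toℕ-fromℕ< _ ⟩
      count (f j)    ∎))
      where open ≡-Reasoning

  ≤count⇒AtLeast : ∀ {k x} → k ≤ count x → AtLeast k P
  ≤count⇒AtLeast {k} {x} k≤count = element , element-injective , P-element
    where
    attained : (i : Fin k) → ∃ λ y → y < x × P y × count y ≡ toℕ i
    attained i = count-attained (<-≤-trans (toℕ<n i) k≤count)

    element : Fin k → ℕ
    element i = proj₁ (attained i)

    P-element : ∀ i → P (element i)
    P-element i = proj₁ (proj₂ (proj₂ (attained i)))

    element-injective : ∀ i j → element i ≡ element j → i ≡ j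
    element-injective i j eq = toℕ-injective (trans (sym (proj₂ (proj₂ (proj₂ (attained i)))))
      (trans (cong count eq) (proj₂ (proj₂ (proj₂ (attained j))))))

open Counting

module _ (dL : PR 1) (rL : PR 2) (isOrder : IsCompLinOrder dL rL) where
  open IsCompLinOrder isOrder using (dL-total; rL-total)

  inL? : Decidable (InL dL)
  inL? x = decide-⇓1 (dL-total x)

  lt? : ∀ x y → Dec (Lt rL x y)
  lt? x y = decide-⇓1 (rL-total x y)

  interval? : ∀ a b → Decidable (IntervalL dL rL a b)
  interval? a b x = inL? x ×-dec (lt? a x ×-dec lt? x b)

  rank : ℕ → ℕ → ℕ → ℕ
  rank a b = count (interval? a b)

  -- The codes below take their arguments in the order (x, a, b).
  intervalᴾ : PR 3
  intervalᴾ =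
    (comp₁ dL (proj (# 0))
       +ᴾ (comp₂ rL (proj (# 1)) (proj (# 0)) +ᴾ comp₂ rL (proj (# 0)) (proj (# 2))))
    ∸ᴾ constᴾ 2

  ⇓-intervalᴾ : ∀ x a b → intervalᴾ ⊢ x ∷ a ∷ b ∷ [] ⇓ bit (interval? a b x)
  ⇓-intervalᴾ x a b = subst (intervalᴾ ⊢ x ∷ a ∷ b ∷ [] ⇓_) (bit-×-dec (inL? x) (lt? a x) (lt? x b))
    (⇓-∸ᴾ (⇓-+ᴾ (⇓-comp₁ ev-proj (⇓-bit-decide-⇓1 (dL-total x)))
                (⇓-+ᴾ (⇓-comp₂ ev-proj ev-proj (⇓-bit-decide-⇓1 (rL-total a x)))
                      (⇓-comp₂ ev-proj ev-proj (⇓-bit-decide-⇓1 (rL-total x b)))))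
          (⇓-constᴾ 2))

  rankᴾ : PR 3
  rankᴾ = prec zer (proj (# 1) +ᴾ comp₃ intervalᴾ (proj (# 0)) (proj (# 2)) (proj (# 3)))

  ⇓-rankᴾ : ∀ x a b → rankᴾ ⊢ x ∷ a ∷ b ∷ [] ⇓ rank a b x
  ⇓-rankᴾ zero a b = ev-prec-z ev-zer
  ⇓-rankᴾ (suc x) a b = ev-prec-s (⇓-rankᴾ x a b)
    (⇓-+ᴾ ev-proj (⇓-comp₃ ev-proj ev-proj ev-proj (⇓-intervalᴾ x a b)))

  IsNthIn : ℕ → ℕ → ℕ → ℕ → Set
  IsNthIn j a b x = IntervalL dL rL a b x × rank a b x ≡ j

  nthᴾ : ℕ → PR 3
  nthᴾ j = (constᴾ 1 ∸ᴾ intervalᴾ) +ᴾ ((rankᴾ ∸ᴾ constᴾ j) +ᴾ (constᴾ j ∸ᴾ rankᴾ))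

  nthᴾ-value : ℕ → ℕ → ℕ → ℕ → ℕ
  nthᴾ-value j x a b = (1 ∸ bit (interval? a b x)) + ((rank a b x ∸ j) + (j ∸ rank a b x))

  ⇓-nthᴾ : ∀ j x a b → nthᴾ j ⊢ x ∷ a ∷ b ∷ [] ⇓ nthᴾ-value j x a b
  ⇓-nthᴾ j x a b = ⇓-+ᴾ (⇓-∸ᴾ (⇓-constᴾ 1) (⇓-intervalᴾ x a b))
                        (⇓-+ᴾ (⇓-∸ᴾ (⇓-rankᴾ x a b) (⇓-constᴾ j))
                              (⇓-∸ᴾ (⇓-constᴾ j) (⇓-rankᴾ x a b)))

  nthᴾ-value≡0⇒ : ∀ {j x a b} → nthᴾ-value j x a b ≡ 0 → IsNthIn j a b x
  nthᴾ-value≡0⇒ {j} {x} {a} {b} eq =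
    1∸bit≡0⇒ (interval? a b x) (m+n≡0⇒m≡0 _ eq) ,
    m∸n+n∸m≡0⇒m≡n (m+n≡0⇒n≡0 (1 ∸ bit (interval? a b x)) eq)

  ⇒nthᴾ-value≡0 : ∀ {j x a b} → IsNthIn j a b x → nthᴾ-value j x a b ≡ 0
  ⇒nthᴾ-value≡0 {x = x} {a} {b} (x∈I , refl)
    rewrite ⇒1∸bit≡0 (interval? a b x) x∈I | n∸n≡0 (rank a b x) = refl

  atLeastᴾ : ℕ → PR 3
  atLeastᴾ k = constᴾ k ∸ᴾ rankᴾ

  ⇓-atLeastᴾ : ∀ k x a b → atLeastᴾ k ⊢ x ∷ a ∷ b ∷ [] ⇓ (k ∸ rank a b x)
  ⇓-atLeastᴾ k x a b = ⇓-∸ᴾ (⇓-constᴾ k) (⇓-rankᴾ x a b)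

  module _ (ψ φ : PR 1) where

    IsNth : ℕ → ℕ → ℕ → Set
    IsNth j n x = ∃ λ a → ∃ λ b → ψ ⟨ n ⟩≡ a × φ ⟨ n ⟩≡ b × IsNthIn j a b x

    nth : ℕ → PR 1
    nth j = comp₂ (mu (nthᴾ j)) ψ φ

    hasAtLeast : ℕ → PR 1
    hasAtLeast k = comp₂ (mu (atLeastᴾ k)) ψ φ

    matchesNth : ℕ → PR 1 → PR 1
    matchesNth j θ = comp₁ isZeroᴾ (comp₃ (nthᴾ j) θ ψ φ)

    nth-sound : ∀ {j n x} → nth j ⟨ n ⟩≡ x → IsNth j n x
    nth-sound {j} (ev-comp (ev-∷ ψ⇓ (ev-∷ φ⇓ ev-[])) μ⇓) =
      _ , _ , ψ⇓ , φ⇓ , nthᴾ-value≡0⇒ (μ-sound (λ y → ⇓-nthᴾ j y _ _) μ⇓)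

    -- μ finds some element of rank j; it is x because the rank is injective on the interval.
    nth-complete : ∀ {j n x} → IsNth j n x → nth j ⟨ n ⟩≡ x
    nth-complete {j} (a , b , ψ⇓ , φ⇓ , isNth@(x∈I , rank≡j)) =
      let y , μ⇓ = μ-complete (λ y → ⇓-nthᴾ j y a b) (⇒nthᴾ-value≡0 isNth)
          y∈I , rank≡j′ = nthᴾ-value≡0⇒ (μ-sound (λ y → ⇓-nthᴾ j y a b) μ⇓)
          y≡x = count-injective (interval? a b) y∈I x∈I (trans rank≡j′ (sym rank≡j))
      in subst (nth j ⟨ _ ⟩≡_) y≡x (⇓-comp₂ ψ⇓ φ⇓ μ⇓)

    IsNth-index-unique : ∀ {i j n x} → IsNth i n x → IsNth j n x → i ≡ j
    IsNth-index-unique {x = x} (a , b , ψ⇓ , φ⇓ , _ , rank≡i) (a′ , b′ , ψ⇓′ , φ⇓′ , _ , rank≡j) =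
      trans (sym rank≡i)
        (trans (cong₂ (λ a b → rank a b x) (⇓-functional ψ⇓ ψ⇓′) (⇓-functional φ⇓ φ⇓′)) rank≡j)

    hasAtLeast-sound : ∀ {k n} → Dom (hasAtLeast k) n → IntAtLeast dL rL ψ φ k n
    hasAtLeast-sound {k} (x , ev-comp (ev-∷ ψ⇓ (ev-∷ φ⇓ ev-[])) μ⇓) =
      _ , _ , ψ⇓ , φ⇓ , ≤count⇒AtLeast (interval? _ _) {x = x}
                          (m∸n≡0⇒m≤n (μ-sound (λ y → ⇓-atLeastᴾ k y _ _) μ⇓))

    hasAtLeast-complete : ∀ {k n} → IntAtLeast dL rL ψ φ k n → Dom (hasAtLeast k) n
    hasAtLeast-complete {k} (a , b , ψ⇓ , φ⇓ , atLeast) =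
      let x , k≤rank = AtLeast⇒≤count (interval? a b) atLeast
          y , μ⇓ = μ-complete (λ y → ⇓-atLeastᴾ k y a b) {x} (m≤n⇒m∸n≡0 k≤rank)
      in y , ⇓-comp₂ ψ⇓ φ⇓ μ⇓

    matchesNth-sound : ∀ {j θ n} → Dom (matchesNth j θ) n → ∃ λ x → θ ⟨ n ⟩≡ x × IsNth j n x
    matchesNth-sound {j}
      (_ , ev-comp (ev-∷ (ev-comp (ev-∷ θ⇓ (ev-∷ ψ⇓ (ev-∷ φ⇓ ev-[]))) nthᴾ⇓) ev-[]) isZero⇓) =
      _ , θ⇓ , _ , _ , ψ⇓ , φ⇓ ,
      nthᴾ-value≡0⇒ (trans (⇓-functional (⇓-nthᴾ j _ _ _) nthᴾ⇓) (isZeroᴾ-⇓⇒≡0 isZero⇓))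

    matchesNth-complete : ∀ {j θ n x} → θ ⟨ n ⟩≡ x → IsNth j n x → Dom (matchesNth j θ) n
    matchesNth-complete {j} {x = x} θ⇓ (a , b , ψ⇓ , φ⇓ , isNth) =
      0 , ⇓-comp₁ (⇓-comp₃ θ⇓ ψ⇓ φ⇓ nthᴾ⇓0) ⇓-isZeroᴾ
      where
      nthᴾ⇓0 : nthᴾ j ⊢ x ∷ a ∷ b ∷ [] ⇓ 0
      nthᴾ⇓0 = subst (nthᴾ j ⊢ x ∷ a ∷ b ∷ [] ⇓_) (⇒nthᴾ-value≡0 isNth) (⇓-nthᴾ j x a b)

    IntAtLeast-suc⇒∃IsNth : ∀ {j n} → IntAtLeast dL rL ψ φ (suc j) n → ∃ (IsNth j n)
    IntAtLeast-suc⇒∃IsNth (a , b , ψ⇓ , φ⇓ , atLeast) =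
      let M , j<rank = AtLeast⇒≤count (interval? a b) atLeast
          x , _ , x∈I , rank≡j = count-attained (interval? a b) {x = M} j<rank
      in x , a , b , ψ⇓ , φ⇓ , x∈I , rank≡j

    Between : PR 1 → ℕ → Set
    Between θ n = ∃ λ a → ∃ λ b → ∃ λ x →
      ψ ⟨ n ⟩≡ a × φ ⟨ n ⟩≡ b × θ ⟨ n ⟩≡ x × IntervalL dL rL a b x

    ψ<θ<φ⇒Between : ∀ {θ n} → (∀ n x → θ ⟨ n ⟩≡ x → InL dL x) →
      (∃ λ a → ∃ λ x → ψ ⟨ n ⟩≡ a × θ ⟨ n ⟩≡ x × Lt rL a x) →
      (∃ λ x → ∃ λ b → θ ⟨ n ⟩≡ x × φ ⟨ n ⟩≡ b × Lt rL x b) →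
      Between θ n
    ψ<θ<φ⇒Between {n = n} θ-in-L (a , x , ψ⇓ , θ⇓ , a<x) (x′ , b , θ⇓′ , φ⇓ , x′<b) =
      a , b , x , ψ⇓ , φ⇓ , θ⇓ ,
      θ-in-L n x θ⇓ , a<x , subst (λ y → Lt rL y b) (⇓-functional θ⇓′ θ⇓) x′<b

    Between⇒matchesNth⊎IntAtLeast : ∀ {θ n} k → Between θ n →
      (∃ λ j → j < k × Dom (matchesNth j θ) n) ⊎ IntAtLeast dL rL ψ φ k n
    Between⇒matchesNth⊎IntAtLeast k (a , b , x , ψ⇓ , φ⇓ , θ⇓ , x∈I) with rank a b x <? k
    ... | yes rank<k =
      inj₁ (rank a b x , rank<k , matchesNth-complete θ⇓ (a , b , ψ⇓ , φ⇓ , x∈I , refl))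
    ... | no rank≮k = inj₂ (a , b , ψ⇓ , φ⇓ , ≤count⇒AtLeast (interval? a b) {x = x} (≮⇒≥ rank≮k))

    LimInfty⇒LimsupInfty : ∀ {C} → Infinite C → LimInfty dL rL C ψ φ → LimsupInfty dL rL C ψ φ
    LimInfty⇒LimsupInfty inf lim k = ⊆*⇒Infinite-∩ inf (lim k)

    module _ {C : ℕ → Set} (coh : Cohesive C) where

      LimsupInfty⇒LimInfty : LimsupInfty dL rL C ψ φ → LimInfty dL rL C ψ φ
      LimsupInfty⇒LimInfty limsup k = ⊆*-mono hasAtLeast-sound (cohesive-⊆*Dom coh (hasAtLeast k)
        (limsup k ∘ Finite-mono λ (c , dom) → c , hasAtLeast-complete dom))

      nth-separated : ∀ {i j θ} → nth i =[ C ] θ → nth j =[ C ] θ → i ≡ j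
      nth-separated {i} {j} nthᵢ=θ nthⱼ=θ = decidable-stable (i ≟ j) λ i≢j →
        ⊆*-inhabited (proj₁ coh) (⊆*-∩ nthᵢ=θ nthⱼ=θ)
          λ (n , _ , (x , nthᵢ⇓ , θ⇓) , (_ , nthⱼ⇓ , θ⇓′)) →
            i≢j (IsNth-index-unique (nth-sound nthᵢ⇓)
                   (subst (IsNth j n) (⇓-functional θ⇓′ θ⇓) (nth-sound nthⱼ⇓)))

      LimInfty⇒nth-∈PowInterval : LimInfty dL rL C ψ φ → ∀ j → PowInterval dL rL C ψ φ (nth j)
      LimInfty⇒nth-∈PowInterval lim j =
        (nth-in-L , ⊆*-mono (λ (x , isNth) → x , nth-complete isNth) hasNth) ,
        ⊆*-mono ψ<nth hasNth , ⊆*-mono nth<φ hasNth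
        where
        hasNth : C ⊆* (λ n → ∃ (IsNth j n))
        hasNth = ⊆*-mono IntAtLeast-suc⇒∃IsNth (lim (suc j))

        nth-in-L : ∀ n x → nth j ⟨ n ⟩≡ x → InL dL x
        nth-in-L n x nth⇓ = let _ , _ , _ , _ , (x∈L , _) , _ = nth-sound nth⇓ in x∈L

        ψ<nth : ∀ {n} → ∃ (IsNth j n) → ∃ λ a → ∃ λ x → ψ ⟨ n ⟩≡ a × nth j ⟨ n ⟩≡ x × Lt rL a x
        ψ<nth (x , isNth@(a , _ , ψ⇓ , _ , (_ , a<x , _) , _)) =
          a , x , ψ⇓ , nth-complete isNth , a<x

        nth<φ : ∀ {n} → ∃ (IsNth j n) → ∃ λ x → ∃ λ b → nth j ⟨ n ⟩≡ x × φ ⟨ n ⟩≡ b × Lt rL x b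
        nth<φ (x , isNth@(_ , b , _ , φ⇓ , (_ , _ , x<b) , _)) =
          x , b , nth-complete isNth , φ⇓ , x<b

      LimInfty⇒PowFar : LimInfty dL rL C ψ φ → PowFar dL rL C ψ φ
      LimInfty⇒PowFar lim = ¬PowFinite-separated nth (LimInfty⇒nth-∈PowInterval lim) nth-separated

      ¬IntAtLeast⇒PowFinite : ∀ k → C ⊆* (λ n → ¬ IntAtLeast dL rL ψ φ k n) →
                              PowFinite C (PowInterval dL rL C ψ φ)
      ¬IntAtLeast⇒PowFinite k fewer = applyUpTo nth k , covered
        where
        covered : ∀ θ → PowInterval dL rL C ψ φ θ →
                  Σ (PR 1) λ θ′ → θ′ ∈ applyUpTo nth k × θ =[ C ] θ′
        covered θ ((θ-in-L , _) , ψ<θ , θ<φ) with cohesive-some-or-none coh (λ j → matchesNth j θ) k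
        ... | inj₁ (j , j<k , C⊆*matches) =
          nth j , ∈-applyUpTo⁺ nth j<k ,
          ⊆*-mono (λ matches → let x , θ⇓ , isNth = matchesNth-sound matches
                               in x , θ⇓ , nth-complete isNth)
                  C⊆*matches
        ... | inj₂ C⊆*none =
          ⊥-elim (⊆*-inhabited (proj₁ coh) (⊆*-∩ C⊆*none (⊆*-∩ fewer (⊆*-∩ ψ<θ θ<φ)))
            λ (_ , _ , none , ¬atLeast , ψ<θₙ , θ<φₙ) →
              [ (λ (j , j<k , matches) → none j j<k matches) , ¬atLeast ]′
                (Between⇒matchesNth⊎IntAtLeast k (ψ<θ<φ⇒Between θ-in-L ψ<θₙ θ<φₙ)))

      PowFar⇒LimInfty : PowFar dL rL C ψ φ → LimInfty dL rL C ψ φ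
      PowFar⇒LimInfty far k with proj₂ coh (hasAtLeast k)
      ... | inj₁ C⊆*hasAtLeast = ⊆*-mono hasAtLeast-sound C⊆*hasAtLeast
      ... | inj₂ fin =
        ⊥-elim (far (¬IntAtLeast⇒PowFinite k (⊆*-mono (_∘ hasAtLeast-complete) (Finite-∩⇒⊆*∁ fin))))

lemma3p8 : (dL : PR 1) (rL : PR 2) → IsCompLinOrder dL rL →
           (C : ℕ → Set) → Cohesive C →
           (ψ φ : PR 1) → IsElem dL C ψ → IsElem dL C φ →
           (PowFar dL rL C ψ φ ⇔ LimInfty dL rL C ψ φ) ×
           (LimInfty dL rL C ψ φ ⇔ LimsupInfty dL rL C ψ φ)
lemma3p8 dL rL isOrder C coh ψ φ _ _ =
  mk⇔ (PowFar⇒LimInfty dL rL isOrder ψ φ coh) (LimInfty⇒PowFar dL rL isOrder ψ φ coh) ,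
  mk⇔ (LimInfty⇒LimsupInfty dL rL isOrder ψ φ (proj₁ coh))
      (LimsupInfty⇒LimInfty dL rL isOrder ψ φ coh)
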